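{- Let $n \ge 3$ and let $P_{\min_{n,0}} = \{1, 1, L(1), L(2), \ldots, L(n-2)\}$ (the Lucas sequence shifted two places right, the minimizing $0$-ordered sequence). Let $T$ be the elongated binary tree of size $n$ that is the Huffman tree of $P_{\min_{n,0}}$. Then $$E(T, P_{\min_{n,0}}) = F(n+3) + F(n+1) - (n+3).$$
   Context: $F(i)$ denotes the $i$-th Fibonacci number: $F(0)=0$, $F(1)=1$, $F(i)=F(i-1)+F(i-2)$ for $i>1$. $L(i)$ denotes the $i$-th Lucas number: $L(1)=1$, $L(2)=3$, $L(i)=L(i-1)+L(i-2)$ for $i>2$. A (strictly) binary tree is an ordered rooted tree in which every non-leaf node has exactly two children; its size is its number of leaves. A binary tree is elongated if among any two sibling nodes at least one is a leaf. For a binary tree $T$ with positive weights $p_1,\dots,p_n$ at its leaves, the weighted external path length is $E(T,P)=\sum_{i=1}^n l_i p_i$, where $l_i$ is the length of the path from the root to leaf $i$. Huffman algorithm on a non-decreasing sequence $P$ of positive integers repeatedly replaces the two smallest weights by their sum (re-sorting each time) until one weight remains; the merges define a Huffman tree of $P$. -}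

module Defs where

open import Data.Nat using (ℕ; zero; suc; _+_; _*_; _∸_; _≤_)
open import Data.List using (List; []; _∷_; map; upTo)
open import Data.List.Relation.Unary.All using (All)
open import Data.List.Relation.Binary.Permutation.Propositional using (_↭_)
open import Data.Sum using (_⊎_)
open import Data.Product using (_×_; ∃)
open import Relation.Binary.PropositionalEquality using (_≡_)

F : ℕ → ℕ
F zero = zero
F (suc zero) = suc zero
F (suc (suc i)) = F (suc i) + F i

-- Lucas numbers: L 1 = 1, L 2 = 3 (L 0 = 2 extends the recurrence).
L : ℕ → ℕ
L zero = 2
L (suc zero) = 1
L (suc (suc i)) = L (suc i) + L i

data Tree : Set where
  leaf : ℕ → Tree
  node : Tree → Tree → Tree

weight : Tree → ℕ
weight (leaf p) = p
weight (node l r) = weight l + weight r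

size : Tree → ℕ
size (leaf _) = 1
size (node l r) = size l + size r

leaves : Tree → List ℕ
leaves (leaf p) = p ∷ []
leaves (node l r) = Data.List._++_ (leaves l) (leaves r)

IsLeaf : Tree → Set
IsLeaf t = ∃ λ p → t ≡ leaf p

data Elongated : Tree → Set where
  leaf : ∀ p → Elongated (leaf p)
  node : ∀ {l r} → IsLeaf l ⊎ IsLeaf r → Elongated l → Elongated r →
         Elongated (node l r)

E' : ℕ → Tree → ℕ
E' d (leaf p) = d * p
E' d (node l r) = E' (suc d) l + E' (suc d) r

E : Tree → ℕ
E = E' 0

-- One run of the Huffman algorithm on a forest (multiset of trees, list up
-- to permutation): repeatedly merge two trees of smallest weight (ties
-- resolved arbitrarily, either child order) until one tree remains.
data HuffmanRun : List Tree → Tree → Set where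
  done  : ∀ t → HuffmanRun (t ∷ []) t
  merge : ∀ {ts} a b rest {T} →
          ts ↭ (a ∷ b ∷ rest) →
          All (λ c → weight a ≤ weight c) rest →
          All (λ c → weight b ≤ weight c) rest →
          HuffmanRun (node a b ∷ rest) T →
          HuffmanRun ts T

HuffmanTree : List ℕ → Tree → Set
HuffmanTree P T = HuffmanRun (map leaf P) T

Pmin0 : ℕ → List ℕ
Pmin0 n = 1 ∷ 1 ∷ map (λ i → L (suc i)) (upTo (n ∸ 2))

-- Every Huffman run on 1, 1, L(1), …, L(n-2) builds the same caterpillar: it first merges the two 1s,
-- and from then on the forest always holds one merged tree of weight L(k+2) − 1 next to the untouched
-- leaves L(k+1), L(k+2), …, so the next merge is forced to join that tree with L(k+1), giving weight
-- L(k+3) − 1. The external path length equals the total weight of all merges, a telescoping sum of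
-- Lucas numbers, and L(n+2) = F(n+3) + F(n+1).
module Submission where

open import Defs
open import Data.Nat using (ℕ; zero; suc; _+_; _*_; _≤_; z≤n; s≤s)
open import Data.Nat.Properties
open import Algebra.Properties.CommutativeSemigroup +-commutativeSemigroup using (xy∙z≈xz∙y)
open import Data.Nat.ListAction using (sum)
open import Data.Nat.ListAction.Properties using (sum-↭)
open import Data.Nat.Tactic.RingSolver using (solve-∀)
open import Data.List using (List; []; _∷_; map; applyUpTo)
open import Data.List.Properties using (map-upTo)
open import Data.List.Relation.Unary.All as All using (All; []; _∷_)
import Data.List.Relation.Unary.All.Properties as All
open import Data.List.Relation.Unary.Any using (here; there)
open import Data.List.Relation.Binary.Permutation.Propositional
  using (_↭_; prep; swap; ↭-refl; ↭-sym; ↭-trans; ↭-reflexive)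
open import Data.List.Relation.Binary.Permutation.Propositional.Properties
  using (∈-resp-↭; drop-∷; map⁺; ↭-length)
open import Data.Product using (_×_; _,_)
open import Data.Sum using (inj₁; inj₂)
open import Relation.Binary.PropositionalEquality as ≡
  using (_≡_; refl; sym; cong; cong₂; module ≡-Reasoning)

open ≡-Reasoning

L-pos : ∀ a → 1 ≤ L a
L-pos zero = s≤s z≤n
L-pos (suc zero) = s≤s z≤n
L-pos (suc (suc a)) = ≤-trans (L-pos (suc a)) (m≤m+n _ _)

L-suc-mono : ∀ a → L (suc a) ≤ L (suc (suc a))
L-suc-mono a = m≤m+n (L (suc a)) (L a)

F-suc-suc+F≡L-suc : ∀ a → F (suc (suc a)) + F a ≡ L (suc a)
F-suc-suc+F≡L-suc zero = refl
F-suc-suc+F≡L-suc (suc zero) = refl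
F-suc-suc+F≡L-suc (suc (suc a))
  rewrite sym (F-suc-suc+F≡L-suc (suc a)) | sym (F-suc-suc+F≡L-suc a) =
  shuffle (F (suc (suc a))) (F (suc a)) (F a)
  where
  shuffle : ∀ x y z → (x + y + x) + (y + z) ≡ (x + y + y) + (x + z)
  shuffle = solve-∀

F+F≡L : ∀ n → F (n + 3) + F (n + 1) ≡ L (n + 2)
F+F≡L n rewrite +-comm n 3 | +-comm n 1 | +-comm n 2 = F-suc-suc+F≡L-suc (suc n)

lucasFrom : ℕ → ℕ → List ℕ
lucasFrom a zero = []
lucasFrom a (suc m) = L a ∷ lucasFrom (suc a) m

applyUpTo-lucasFrom : ∀ (f : ℕ → ℕ) a m → (∀ i → f i ≡ L (a + i)) → applyUpTo f m ≡ lucasFrom a m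
applyUpTo-lucasFrom f a zero f≗ = refl
applyUpTo-lucasFrom f a (suc m) f≗ =
  cong₂ _∷_ (≡.trans (f≗ 0) (cong L (+-identityʳ a)))
    (applyUpTo-lucasFrom (λ i → f (suc i)) (suc a) m (λ i → ≡.trans (f≗ (suc i)) (cong L (+-suc a i))))

Pmin0-lucasFrom : ∀ m → Pmin0 (2 + m) ≡ 1 ∷ 1 ∷ lucasFrom 1 m
Pmin0-lucasFrom m =
  cong (λ xs → 1 ∷ 1 ∷ xs)
    (≡.trans (map-upTo (λ i → L (suc i)) m) (applyUpTo-lucasFrom _ 1 m (λ _ → refl)))

lucasFrom-lowerBound : ∀ {v} a j → v ≤ L (suc a) → All (v ≤_) (lucasFrom (suc a) j)
lucasFrom-lowerBound a zero v≤ = []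
lucasFrom-lowerBound a (suc j) v≤ = v≤ ∷ lucasFrom-lowerBound (suc a) j (≤-trans v≤ (L-suc-mono a))

↭-min-head : ∀ {p q : ℕ} {xs ys} → All (p ≤_) xs → All (q ≤_) ys → p ∷ xs ↭ q ∷ ys → p ≡ q
↭-min-head {p} {q} p≤xs q≤ys xs↭ys with ∈-resp-↭ (↭-sym xs↭ys) (here refl)
... | here q≡p = sym q≡p
... | there q∈xs with ∈-resp-↭ xs↭ys (here refl)
...   | here p≡q = p≡q
...   | there p∈ys = ≤-antisym (All.lookup p≤xs q∈xs) (All.lookup q≤ys p∈ys)

↭-two-smallest-ordered : ∀ {p q x y : ℕ} {xs ys} → p ≤ q → All (q ≤_) xs →
  x ≤ y → All (y ≤_) ys → p ∷ q ∷ xs ↭ x ∷ y ∷ ys → x ≡ p × y ≡ q × ys ↭ xs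
↭-two-smallest-ordered p≤q q≤xs x≤y y≤ys ↭xy
  with ↭-min-head (p≤q ∷ All.map (≤-trans p≤q) q≤xs) (x≤y ∷ All.map (≤-trans x≤y) y≤ys) ↭xy
... | refl with ↭-min-head q≤xs y≤ys (drop-∷ ↭xy)
...   | refl = refl , refl , ↭-sym (drop-∷ (drop-∷ ↭xy))

↭-two-smallest : ∀ {p q x y : ℕ} {xs ys} → p ≤ q → All (q ≤_) xs →
  All (x ≤_) ys → All (y ≤_) ys → p ∷ q ∷ xs ↭ x ∷ y ∷ ys → x + y ≡ p + q × ys ↭ xs
↭-two-smallest {x = x} {y} p≤q q≤xs x≤ys y≤ys ↭xy with ≤-total x y
... | inj₁ x≤y with ↭-two-smallest-ordered p≤q q≤xs x≤y y≤ys ↭xy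
...   | refl , refl , ys↭ = refl , ys↭
↭-two-smallest {x = x} {y} p≤q q≤xs x≤ys y≤ys ↭xy
    | inj₂ y≤x with ↭-two-smallest-ordered p≤q q≤xs y≤x x≤ys (↭-trans ↭xy (swap x y ↭-refl))
...   | refl , refl , ys↭ = +-comm x y , ys↭

cost : List Tree → ℕ
cost ts = sum (map E ts)

E'-suc : ∀ d t → E' (suc d) t ≡ E' d t + weight t
E'-suc d (leaf p) = +-comm p (d * p)
E'-suc d (node l r) rewrite E'-suc (suc d) l | E'-suc (suc d) r =
  shuffle (E' (suc d) l) (E' (suc d) r) (weight l) (weight r)
  where
  shuffle : ∀ a b c e → (a + c) + (b + e) ≡ (a + b) + (c + e)
  shuffle = solve-∀

cost-merge : ∀ {ts a b rest} → ts ↭ a ∷ b ∷ rest → cost (node a b ∷ rest) ≡ cost ts + weight (node a b)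
cost-merge {ts} {a} {b} {rest} ts↭ = begin
  E' 1 a + E' 1 b + cost rest                          ≡⟨ cong (_+ cost rest) (cong₂ _+_ (E'-suc 0 a) (E'-suc 0 b)) ⟩
  (E a + weight a) + (E b + weight b) + cost rest      ≡⟨ shuffle (E a) (weight a) (E b) (weight b) (cost rest) ⟩
  cost (a ∷ b ∷ rest) + (weight a + weight b)          ≡⟨ cong (_+ _) (sum-↭ (map⁺ E (↭-sym ts↭))) ⟩
  cost ts + weight (node a b)                          ∎
  where
  shuffle : ∀ ea wa eb wb s → (ea + wa) + (eb + wb) + s ≡ (ea + (eb + s)) + (wa + wb)
  shuffle = solve-∀

cost-leaves : ∀ xs → cost (map leaf xs) ≡ 0
cost-leaves [] = refl
cost-leaves (x ∷ xs) = cost-leaves xs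

weight-leaves : ∀ xs → map weight (map leaf xs) ≡ xs
weight-leaves [] = refl
weight-leaves (x ∷ xs) = cong (x ∷_) (weight-leaves xs)

merge-weights : ∀ {ts a b rest p q ws} → p ≤ q → All (q ≤_) ws → map weight ts ↭ p ∷ q ∷ ws →
  ts ↭ a ∷ b ∷ rest → All (λ c → weight a ≤ weight c) rest → All (λ c → weight b ≤ weight c) rest →
  weight (node a b) ≡ p + q × map weight rest ↭ ws
merge-weights p≤q q≤ws ts↭pq ts↭ab a≤rest b≤rest =
  ↭-two-smallest p≤q q≤ws (All.map⁺ a≤rest) (All.map⁺ b≤rest)
    (↭-trans (↭-sym ts↭pq) (map⁺ weight ts↭ab))

-- Subtraction-free forms of w = L(k+2) − 1 and of E T = cost ts + L(k+j+4) − L(k+4) − j.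
caterpillar-cost : ∀ k j {w ts T} → HuffmanRun ts T →
  map weight ts ↭ w ∷ lucasFrom (suc k) j → w + 1 ≡ L (2 + k) →
  E T + j + L (4 + k) ≡ cost ts + L (4 + k + j)
caterpillar-cost k zero (done t) _ _ rewrite +-identityʳ k = refl
caterpillar-cost k (suc j) (done t) ts↭ _ with ↭-length ts↭
... | ()
caterpillar-cost k zero (merge a b rest ts↭ _ _ _) ts↭w _
  with ↭-length (↭-trans (↭-sym (map⁺ weight ts↭)) ts↭w)
... | ()
caterpillar-cost k (suc j) {w} {ts} {T} (merge a b rest ts↭ a≤rest b≤rest run) ts↭w w+1≡
  with merge-weights L≤w (lucasFrom-lowerBound (suc k) j w≤L) (↭-trans ts↭w (swap w _ ↭-refl))
         ts↭ a≤rest b≤rest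
  where
  L≤w : L (suc k) ≤ w
  L≤w = +-cancelʳ-≤ 1 _ _ (≤-trans (+-monoʳ-≤ (L (suc k)) (L-pos k)) (≤-reflexive (sym w+1≡)))
  w≤L : w ≤ L (suc (suc k))
  w≤L = ≤-trans (m≤m+n w 1) (≤-reflexive w+1≡)
... | sw≡ , rest↭ = +-cancelʳ-≡ sw _ _ (begin
  E T + suc j + L (4 + k) + sw              ≡⟨ shuffle (E T) j (L (4 + k)) sw ⟩
  E T + j + (L (4 + k) + (sw + 1))          ≡⟨ cong (λ z → E T + j + (L (4 + k) + z)) sw+1≡ ⟩
  E T + j + L (5 + k)                       ≡⟨ caterpillar-cost (suc k) j run (prep sw rest↭) sw+1≡ ⟩
  cost (node a b ∷ rest) + L (5 + k + j)    ≡⟨ cong₂ _+_ (cost-merge ts↭) (cong (λ i → L (4 + i)) (sym (+-suc k j))) ⟩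
  cost ts + sw + L (4 + k + suc j)          ≡⟨ xy∙z≈xz∙y (cost ts) sw _ ⟩
  cost ts + L (4 + k + suc j) + sw          ∎)
  where
  sw = weight (node a b)
  sw+1≡ : sw + 1 ≡ L (3 + k)
  sw+1≡ = begin
    sw + 1                       ≡⟨ cong (_+ 1) sw≡ ⟩
    L (suc k) + w + 1            ≡⟨ +-assoc (L (suc k)) w 1 ⟩
    L (suc k) + (w + 1)          ≡⟨ cong (L (suc k) +_) w+1≡ ⟩
    L (suc k) + L (2 + k)        ≡⟨ +-comm (L (suc k)) _ ⟩
    L (3 + k)                    ∎
  shuffle : ∀ e j l s → e + suc j + l + s ≡ e + j + (l + (s + 1))
  shuffle = solve-∀

huffman-Pmin0-cost : ∀ m {T} → HuffmanTree (Pmin0 (2 + m)) T → E T + (2 + m + 3) ≡ L (2 + m + 2)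
huffman-Pmin0-cost m {T} huff
  with ≡.subst (λ P → HuffmanTree P T) (Pmin0-lucasFrom m) huff
... | merge a b rest ts↭ a≤rest b≤rest run
  with merge-weights ≤-refl (lucasFrom-lowerBound 0 m ≤-refl)
         (↭-reflexive (weight-leaves (1 ∷ 1 ∷ lucasFrom 1 m))) ts↭ a≤rest b≤rest
... | sw≡2 , rest↭ = +-cancelˡ-≡ 2 _ _ (begin
  2 + (E T + (2 + m + 3))                    ≡⟨ shuffle (E T) m ⟩
  E T + m + L 4                              ≡⟨ caterpillar-cost 0 m run (prep _ rest↭) (cong (_+ 1) sw≡2) ⟩
  cost (node a b ∷ rest) + L (4 + m)         ≡⟨ cong (_+ L (4 + m)) (cost-merge ts↭) ⟩
  cost (map leaf (1 ∷ 1 ∷ lucasFrom 1 m)) + weight (node a b) + L (4 + m)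
    ≡⟨ cong₂ (λ c s → c + s + L (4 + m)) (cost-leaves (1 ∷ 1 ∷ lucasFrom 1 m)) sw≡2 ⟩
  2 + L (4 + m)                              ≡⟨ cong (λ i → 2 + L (2 + i)) (+-comm 2 m) ⟩
  2 + L (2 + m + 2)                          ∎)
  where
  shuffle : ∀ e m → 2 + (e + (2 + m + 3)) ≡ e + m + 7
  shuffle = solve-∀

corollary3 : (n : ℕ) → 3 ≤ n → (T : Tree) → HuffmanTree (Pmin0 n) T → Elongated T →
    size T ≡ n → E T + (n + 3) ≡ F (n + 3) + F (n + 1)
corollary3 n@(suc (suc m)) (s≤s (s≤s _)) T huff _ _ = ≡.trans (huffman-Pmin0-cost m huff) (sym (F+F≡L n))
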